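{- Let $P\subseteq\mathcal P$ be finite, $p\in P$, $k\ge0$ and $\delta\in D^P_k(\mathsf T_n\mathbf D)$. For every $\mathsf T_n\mathbf D$-model $(M',s')$ with $M',s'\models\delta^p$ there is a $\mathsf T_n\mathbf D$-model $(M,s)$ with $M,s\models\delta$ that is collectively $p$-bisimilar to $(M',s')$.
   Context: Fix a finite nonempty set $\mathcal A$ of $n$ agents and a countable set $\mathcal P$ of atoms; $\mathcal P^+(\mathcal A)$ is the set of nonempty subsets of $\mathcal A$. Models $(S,R,V)$: $\mathbf D_{\mathcal B}$ is the box for $R_{\mathcal B}=\bigcap_{i\in\mathcal B}R_i$, $\hat{\mathbf D}_{\mathcal B}=\neg\mathbf D_{\mathcal B}\neg$. A $\mathsf T_n\mathbf D$-model is a model in which every $R_i$ is reflexive; $D^P_k(\mathsf T_n\mathbf D)$ consists of the members of $D^P_k$ true at some world of some $\mathsf T_n\mathbf D$-model. $\nabla_{\mathcal B}\Phi=\mathbf D_{\mathcal B}(\bigvee\Phi)\wedge\bigwedge\{\hat{\mathbf D}_{\mathcal B}\phi\mid\phi\in\Phi\}$. $D^P_0$: minterms of $P$; $D^P_{k+1}$: formulas $\delta_0\wedge\bigwedge_{\mathcal B\in\mathcal P^+(\mathcal A)}\nabla_{\mathcal B}\Phi_{\mathcal B}$ with $\delta_0\in D^P_0$, $\Phi_{\mathcal B}\subseteq D^P_k$. $\delta^p$ is obtained from $\delta$ by replacing every occurrence of $\neg p$ by $\top$ and subsequently every remaining occurrence of $p$ by $\top$. Collective $p$-bisimilarity of $(M,s)$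 and $(M',s')$: there is a relation $\rho\ni(s,s')$ such that related worlds agree on every atom other than $p$ and, for every $\mathcal C\in\mathcal P^+(\mathcal A)$, every $R_{\mathcal C}$-successor of one related world is $\rho$-related to some $R'_{\mathcal C}$-successor of the other, and vice versa. -}

module Defs where

open import Data.Nat using (ℕ; zero; suc; _≟_)
open import Data.Bool using (Bool; true; false; if_then_else_)
open import Data.Fin using (Fin)
open import Data.Fin.Subset using (Subset; inside; outside; _∈_; Nonempty)
open import Data.Vec using ([]; _∷_)
open import Data.List using (List; []; _∷_; map; _++_; foldr)
open import Data.List.Relation.Unary.All using (All)
open import Data.Product using (Σ; ∃; _×_; _,_)
open import Data.Empty using (⊥)
open import Data.Unit using (⊤)
open import Data.Sum using (_⊎_)
open import Relation.Nullary using (¬_; yes; no)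
open import Relation.Binary.PropositionalEquality using (_≡_)

-- Atoms are natural numbers (a countable set 𝒫); agents are Fin n.
-- Formulas of the language with distributed-knowledge boxes 𝐃_B, B ⊆ agents.
data Form (n : ℕ) : Set where
  atom : ℕ → Form n
  ⊤f   : Form n
  ⊥f   : Form n
  ¬f_  : Form n → Form n
  _∧f_ : Form n → Form n → Form n
  _∨f_ : Form n → Form n → Form n
  𝐃    : Subset n → Form n → Form n

𝐃̂ : ∀ {n} → Subset n → Form n → Form n
𝐃̂ B φ = ¬f (𝐃 B (¬f φ))

⋀ : ∀ {n} → List (Form n) → Form n
⋀ = foldr _∧f_ ⊤f

⋁ : ∀ {n} → List (Form n) → Form n
⋁ = foldr _∨f_ ⊥f

∇ : ∀ {n} → Subset n → List (Form n) → Form n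
∇ B Φ = 𝐃 B (⋁ Φ) ∧f ⋀ (map (𝐃̂ B) Φ)

allSubsets : (n : ℕ) → List (Subset n)
allSubsets zero = [] ∷ []
allSubsets (suc n) = map (inside ∷_) (allSubsets n) ++ map (outside ∷_) (allSubsets n)

nonemptySubsets : (n : ℕ) → List (Subset n)
nonemptySubsets zero = []
nonemptySubsets (suc n) = map (inside ∷_) (allSubsets n) ++ map (outside ∷_) (nonemptySubsets n)

literal : ∀ {n} → (ℕ → Bool) → ℕ → Form n
literal sign q = if sign q then atom q else ¬f (atom q)

minterm : ∀ {n} → List ℕ → (ℕ → Bool) → Form n
minterm P sign = ⋀ (map (literal sign) P)

IsMinterm : ∀ {n} → List ℕ → Form n → Set
IsMinterm P δ = Σ (ℕ → Bool) λ sign → δ ≡ minterm P sign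

InD : (n : ℕ) → List ℕ → ℕ → Form n → Set
InD n P zero δ = IsMinterm P δ
InD n P (suc k) δ =
  Σ (Form n) λ δ₀ → Σ (Subset n → List (Form n)) λ Φ →
    IsMinterm P δ₀ × (∀ B → All (InD n P k) (Φ B)) ×
    (δ ≡ (δ₀ ∧f ⋀ (map (λ B → ∇ B (Φ B)) (nonemptySubsets n))))

record Model (n : ℕ) : Set₁ where
  field
    S : Set
    R : Fin n → S → S → Set
    V : ℕ → S → Bool

open Model public

RB : ∀ {n} (M : Model n) → Subset n → S M → S M → Set
RB M B w v = ∀ i → i ∈ B → R M i w v

_,_⊨_ : ∀ {n} (M : Model n) → S M → Form n → Set
M , w ⊨ atom q = V M q w ≡ true
M , w ⊨ ⊤f = ⊤
M , w ⊨ ⊥f = ⊥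
M , w ⊨ (¬f φ) = ¬ (M , w ⊨ φ)
M , w ⊨ (φ ∧f ψ) = (M , w ⊨ φ) × (M , w ⊨ ψ)
M , w ⊨ (φ ∨f ψ) = (M , w ⊨ φ) ⊎ (M , w ⊨ ψ)
M , w ⊨ 𝐃 B φ = ∀ v → RB M B w v → M , v ⊨ φ

IsTnD : ∀ {n} → Model n → Set
IsTnD M = ∀ i w → R M i w w

InDT : (n : ℕ) → List ℕ → ℕ → Form n → Set₁
InDT n P k δ = InD n P k δ × Σ (Model n) λ M → IsTnD M × Σ (S M) λ w → M , w ⊨ δ

elimNeg : ∀ {n} → ℕ → Form n → Form n
elimNeg p (atom q) = atom q
elimNeg p ⊤f = ⊤f
elimNeg p ⊥f = ⊥f
elimNeg p (¬f atom q) with q ≟ p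
... | yes _ = ⊤f
... | no _ = ¬f atom q
elimNeg p (¬f φ) = ¬f elimNeg p φ
elimNeg p (φ ∧f ψ) = elimNeg p φ ∧f elimNeg p ψ
elimNeg p (φ ∨f ψ) = elimNeg p φ ∨f elimNeg p ψ
elimNeg p (𝐃 B φ) = 𝐃 B (elimNeg p φ)

elimPos : ∀ {n} → ℕ → Form n → Form n
elimPos p (atom q) with q ≟ p
... | yes _ = ⊤f
... | no _ = atom q
elimPos p ⊤f = ⊤f
elimPos p ⊥f = ⊥f
elimPos p (¬f φ) = ¬f elimPos p φ
elimPos p (φ ∧f ψ) = elimPos p φ ∧f elimPos p ψ
elimPos p (φ ∨f ψ) = elimPos p φ ∨f elimPos p ψ
elimPos p (𝐃 B φ) = 𝐃 B (elimPos p φ)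

_^_ : ∀ {n} → Form n → ℕ → Form n
δ ^ p = elimPos p (elimNeg p δ)

CollBisim : ∀ {n} → ℕ → (M : Model n) → S M → (M' : Model n) → S M' → Set₁
CollBisim {n} p M s M' s' =
  Σ (S M → S M' → Set) λ ρ →
    ρ s s' ×
    (∀ w w' → ρ w w' →
      (∀ q → ¬ (q ≡ p) → V M q w ≡ V M' q w') ×
      (∀ (C : Subset n) → Nonempty C →
        (∀ v → RB M C w v → ∃ λ v' → RB M' C w' v' × ρ v v') ×
        (∀ v' → RB M' C w' v' → ∃ λ v → RB M C w v × ρ v v')))

{-# OPTIONS --safe #-}
-- Every δ ∈ D^P_k is the formula ⟦ t ⟧ of a depth-k description t: a sign on P
-- and, for each nonempty group B, the list of depth-(k-1) descriptions of the
-- B-successors. Let N be a T_nD-model realising t. Unravel M′ from s′ into a tree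
-- whose nodes of height l carry a world w of M′ and a depth-l description that is
-- realised in N and whose p-reduct holds at w; a node takes p from its description
-- and the other atoms from w, and is entered from its parent through a single
-- group, along an edge realised in N. Below height 0 the tree continues as a copy
-- of M′, so projecting to M′ is a collective p-bisimulation. For the truth lemma,
-- each R_C-successor of a node (the node itself, by reflexivity of N, or a child
-- entered through a group containing C) is realised in N at an R_C-successor of a
-- realisation of the node, hence matches a listed C-successor description, since
-- two descriptions realised at one world are equivalent. Realisability is
-- double-negated, like the semantics of 𝐃̂; decidability of that equivalence
-- removes the double negation.
module Submission where

open import Defs
open import Data.Nat using (ℕ; zero; suc; _≥_; _≤_; s≤s; _≟_)
open import Data.Nat.Properties using (≤-refl; m≤n⇒m≤1+n)
open import Data.Bool using (Bool; true; false) renaming (_≟_ to _≟ᵇ_)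
open import Data.Bool.Properties using (¬-not; not-¬)
open import Data.Fin using (Fin; zero; suc)
open import Data.Fin.Subset using (Subset; inside; outside; Nonempty; _⊆_)
  renaming (_∈_ to _∈ₛ_; ⊥ to ∅)
open import Data.Vec using ([]; _∷_; here; there)
open import Data.List using (List; []; _∷_; map)
open import Data.List.Membership.Propositional using (_∈_; find)
open import Data.List.Membership.Propositional.Properties
  using (∈-map⁺; ∈-map⁻; ∈-++⁺ˡ; ∈-++⁺ʳ; ∈-++⁻)
open import Data.List.Properties using (map-cong)
open import Data.List.Relation.Unary.All as All using (All; []; _∷_)
open import Data.List.Relation.Unary.Any as Any using (Any; here; there)
import Data.List.Relation.Unary.All.Properties as AllP
import Data.List.Relation.Unary.Any.Properties as AnyP
open import Data.Product using (Σ; ∃; ∃₂; _×_; _,_; proj₁; proj₂)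
open import Data.Sum using (inj₁; inj₂)
open import Data.Unit using (tt)
open import Data.Empty using (⊥-elim)
open import Relation.Nullary using (¬_; Dec; yes; no)
open import Relation.Nullary.Decidable using (_×-dec_; decidable-stable)
open import Relation.Binary.PropositionalEquality
  using (_≡_; _≢_; refl; sym; trans; cong; cong₂; subst)

∈-allSubsets : ∀ {m} (C : Subset m) → C ∈ allSubsets m
∈-allSubsets [] = here refl
∈-allSubsets (inside ∷ C) = ∈-++⁺ˡ (∈-map⁺ (inside ∷_) (∈-allSubsets C))
∈-allSubsets (outside ∷ C) = ∈-++⁺ʳ _ (∈-map⁺ (outside ∷_) (∈-allSubsets C))

∈-nonemptySubsets : ∀ {m} {C : Subset m} → Nonempty C → C ∈ nonemptySubsets m
∈-nonemptySubsets {C = inside ∷ C} _ = ∈-++⁺ˡ (∈-map⁺ (inside ∷_) (∈-allSubsets C))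
∈-nonemptySubsets {C = outside ∷ C} (zero , ())
∈-nonemptySubsets {C = outside ∷ C} (suc i , there i∈C) =
  ∈-++⁺ʳ _ (∈-map⁺ (outside ∷_) (∈-nonemptySubsets (i , i∈C)))

nonemptySubsets-nonempty : ∀ {m} {C : Subset m} → C ∈ nonemptySubsets m → Nonempty C
nonemptySubsets-nonempty {suc m} C∈ with ∈-++⁻ (map (inside ∷_) (allSubsets m)) C∈
... | inj₁ C∈ᵢ with ∈-map⁻ (inside ∷_) C∈ᵢ
...   | _ , _ , refl = zero , here
nonemptySubsets-nonempty {suc m} C∈ | inj₂ C∈ₒ with ∈-map⁻ (outside ∷_) C∈ₒ
...   | _ , D∈ , refl with nonemptySubsets-nonempty D∈
...     | i , i∈D = suc i , there i∈D

map-preimage : ∀ {A B : Set} {f : A → B} {ys : List B} →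
               All (λ y → ∃ λ x → f x ≡ y) ys → ∃ λ xs → map f xs ≡ ys
map-preimage [] = [] , refl
map-preimage ((x , refl) ∷ preimages) =
  let xs , e = map-preimage preimages in x ∷ xs , cong (_ ∷_) e

□ ◇ : ∀ {n} (K : Model n) → Subset n → (S K → Set) → S K → Set
□ K B X u = ∀ v → RB K B u v → X v
◇ K B X u = ¬ □ K B (λ v → ¬ X v) u

◇-map : ∀ {n} {K : Model n} {B X Y u} → (∀ {v} → X v → Y v) → ◇ K B X u → ◇ K B Y u
◇-map X⇒Y ◇X □¬Y = ◇X (λ v r x → □¬Y v r (X⇒Y x))

RB-antitone : ∀ {n} {K : Model n} {B C u v} → C ⊆ B → RB K B u v → RB K C u v
RB-antitone C⊆B uv i i∈C = uv i (C⊆B i∈C)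

module _ {n : ℕ} (p : ℕ) where

  -- elimNeg fires only on ¬ atom, and a conjunction is never an atom.
  ^-𝐃̂-⋀ : ∀ B (φs : List (Form n)) → 𝐃̂ B (⋀ φs) ^ p ≡ 𝐃̂ B (⋀ φs ^ p)
  ^-𝐃̂-⋀ B [] = refl
  ^-𝐃̂-⋀ B (_ ∷ _) = refl

  elimPos-atom : ∀ {q} → q ≢ p → elimPos {n} p (atom q) ≡ atom q
  elimPos-atom {q} q≢p with q ≟ p
  ... | yes q≡p = ⊥-elim (q≢p q≡p)
  ... | no _ = refl

  elimNeg-¬atom : ∀ {q} → q ≢ p → elimNeg {n} p (¬f atom q) ≡ ¬f atom q
  elimNeg-¬atom {q} q≢p with q ≟ p
  ... | yes q≡p = ⊥-elim (q≢p q≡p)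
  ... | no _ = refl

  literal-^ : ∀ s q → q ≢ p → literal {n} s q ^ p ≡ literal s q
  literal-^ s q q≢p with s q
  ... | true = elimPos-atom q≢p
  ... | false = trans (cong (elimPos p) (elimNeg-¬atom q≢p)) (cong ¬f_ (elimPos-atom q≢p))

module _ {n : ℕ} (K : Model n) where

  ⊨⋀⇒All : ∀ {A : Set} (f : A → Form n) xs {u} → K , u ⊨ ⋀ (map f xs) → All (λ x → K , u ⊨ f x) xs
  ⊨⋀⇒All f [] _ = []
  ⊨⋀⇒All f (x ∷ xs) (h , hs) = h ∷ ⊨⋀⇒All f xs hs

  All⇒⊨⋀ : ∀ {A : Set} (f : A → Form n) xs {u} → All (λ x → K , u ⊨ f x) xs → K , u ⊨ ⋀ (map f xs)
  All⇒⊨⋀ f [] _ = tt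
  All⇒⊨⋀ f (x ∷ xs) (h ∷ hs) = h , All⇒⊨⋀ f xs hs

  ⊨⋁⇒Any : ∀ {A : Set} (f : A → Form n) xs {u} → K , u ⊨ ⋁ (map f xs) → Any (λ x → K , u ⊨ f x) xs
  ⊨⋁⇒Any f (x ∷ xs) (inj₁ h) = here h
  ⊨⋁⇒Any f (x ∷ xs) (inj₂ h) = there (⊨⋁⇒Any f xs h)

  Any⇒⊨⋁ : ∀ {A : Set} (f : A → Form n) xs {u} → Any (λ x → K , u ⊨ f x) xs → K , u ⊨ ⋁ (map f xs)
  Any⇒⊨⋁ f (x ∷ xs) (here h) = inj₁ h
  Any⇒⊨⋁ f (x ∷ xs) (there h) = inj₂ (Any⇒⊨⋁ f xs h)

  ⊨literal⇒ : ∀ s q {u} → K , u ⊨ literal s q → V K q u ≡ s q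
  ⊨literal⇒ s q h with s q
  ... | true = h
  ... | false = ¬-not h

  ⊨literal⇐ : ∀ s q {u} → V K q u ≡ s q → K , u ⊨ literal s q
  ⊨literal⇐ s q e with s q
  ... | true = e
  ... | false = not-¬ e

  ⊨minterm⇒ : ∀ P s {u} → K , u ⊨ minterm P s → All (λ q → V K q u ≡ s q) P
  ⊨minterm⇒ P s h = All.map (⊨literal⇒ s _) (⊨⋀⇒All (literal s) P h)

  ⊨minterm⇐ : ∀ P s {u} → All (λ q → V K q u ≡ s q) P → K , u ⊨ minterm P s
  ⊨minterm⇐ P s h = All⇒⊨⋀ (literal s) P (All.map (⊨literal⇐ s _) h)

  module _ (p : ℕ) where

    ⊨⋀^⇒All : ∀ {A : Set} (f : A → Form n) xs {u} →
              K , u ⊨ (⋀ (map f xs) ^ p) → All (λ x → K , u ⊨ (f x ^ p)) xs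
    ⊨⋀^⇒All f [] _ = []
    ⊨⋀^⇒All f (x ∷ xs) (h , hs) = h ∷ ⊨⋀^⇒All f xs hs

    ⊨⋁^⇒Any : ∀ {A : Set} (f : A → Form n) xs {u} →
              K , u ⊨ (⋁ (map f xs) ^ p) → Any (λ x → K , u ⊨ (f x ^ p)) xs
    ⊨⋁^⇒Any f (x ∷ xs) (inj₁ h) = here h
    ⊨⋁^⇒Any f (x ∷ xs) (inj₂ h) = there (⊨⋁^⇒Any f xs h)

    ⊨minterm^⇒ : ∀ P s {u} → K , u ⊨ (minterm P s ^ p) → All (λ q → q ≢ p → V K q u ≡ s q) P
    ⊨minterm^⇒ P s {u} h =
      All.map (λ {q} ⊨lit q≢p → ⊨literal⇒ s q (subst (K , u ⊨_) (literal-^ p s q q≢p) ⊨lit))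
              (⊨⋀^⇒All (literal s) P h)

module Descriptions (n : ℕ) (P : List ℕ) where

  𝒫⁺ : List (Subset n)
  𝒫⁺ = nonemptySubsets n

  -- The paper's δ₀ ∧ ⋀_B ∇_B Φ_B, with the minterm δ₀ given by its sign.
  Desc : ℕ → Set
  Desc zero = ℕ → Bool
  Desc (suc j) = (ℕ → Bool) × (Subset n → List (Desc j))

  ⟦_⟧ : ∀ {j} → Desc j → Form n
  ⟦_⟧ {zero} s = minterm P s
  ⟦_⟧ {suc j} (s , Ψ) = minterm P s ∧f ⋀ (map (λ B → ∇ B (map ⟦_⟧ (Ψ B))) 𝒫⁺)

  fromInD : ∀ k {δ} → InD n P k δ → Σ (Desc k) λ t → ⟦ t ⟧ ≡ δ
  fromInD zero (s , δ≡) = s , sym δ≡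
  fromInD (suc k) (δ₀ , Φ , (s , δ₀≡) , Φ⊆D , δ≡) =
    (s , λ B → proj₁ (preimage B)) ,
    trans (cong₂ _∧f_ (sym δ₀≡) (cong ⋀ (map-cong (λ B → cong (∇ B) (proj₂ (preimage B))) 𝒫⁺)))
          (sym δ≡)
    where
    preimage : ∀ B → ∃ λ ts → map ⟦_⟧ ts ≡ Φ B
    preimage B = map-preimage (All.map (fromInD k) (Φ⊆D B))

  sign : ∀ {j} → Desc j → ℕ → Bool
  sign {zero} s = s
  sign {suc j} (s , _) = s

  truncate : ∀ {j l} → j ≤ l → Desc l → Desc j
  truncate {zero} _ t = sign t
  truncate {suc j} (s≤s j≤l) (s , Ψ) = s , λ B → map (truncate j≤l) (Ψ B)

  SameSign : (ℕ → Bool) → (ℕ → Bool) → Set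
  SameSign s s′ = All (λ q → s q ≡ s′ q) P

  _≈_ : ∀ {j} → Desc j → Desc j → Set
  _≈_ {zero} s s′ = SameSign s s′
  _≈_ {suc j} (s , Ψ) (s′ , Ψ′) = SameSign s s′ ×
    All (λ B → All (λ a → Any (a ≈_) (Ψ′ B)) (Ψ B) × All (λ b → Any (_≈ b) (Ψ B)) (Ψ′ B)) 𝒫⁺

  _≈?_ : ∀ {j} (a b : Desc j) → Dec (a ≈ b)
  _≈?_ {zero} s s′ = All.all? (λ q → s q ≟ᵇ s′ q) P
  _≈?_ {suc j} (s , Ψ) (s′ , Ψ′) = All.all? (λ q → s q ≟ᵇ s′ q) P ×-dec
    All.all? (λ B → All.all? (λ a → Any.any? (a ≈?_) (Ψ′ B)) (Ψ B) ×-dec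
                    All.all? (λ b → Any.any? (_≈? b) (Ψ B)) (Ψ′ B)) 𝒫⁺

  -- Agrees is the clause for the sign: Exactly gives the semantics of ⟦ t ⟧,
  -- AgreesOff p that of ⟦ t ⟧ ^ p.
  module Realisation (K : Model n) (Agrees : S K → (ℕ → Bool) → Set) where

    _⊩_ : ∀ {j} → S K → Desc j → Set
    _⊩_ {zero} u s = Agrees u s
    _⊩_ {suc j} u (s , Ψ) = Agrees u s ×
      All (λ B → □ K B (λ v → Any (v ⊩_) (Ψ B)) u × All (λ a → ◇ K B (_⊩ a) u) (Ψ B)) 𝒫⁺

    ⊩-sign : ∀ {j u} (t : Desc j) → u ⊩ t → Agrees u (sign t)
    ⊩-sign {zero} _ u⊩t = u⊩t
    ⊩-sign {suc j} _ u⊩t = proj₁ u⊩t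

    ⊩-truncate : ∀ {j l u} (j≤l : j ≤ l) (t : Desc l) → u ⊩ t → u ⊩ truncate j≤l t
    ⊩-truncate {zero} _ t u⊩t = ⊩-sign t u⊩t
    ⊩-truncate {suc j} (s≤s j≤l) (s , Ψ) (u⊩s , u⊩Ψ) = u⊩s ,
      All.map (λ (□Ψ , ◇Ψ) → (λ v uv → AnyP.map⁺ (Any.map (λ {a} → ⊩-truncate j≤l a) (□Ψ v uv))) ,
                              AllP.map⁺ (All.map (λ {a} → ◇-map {K = K} (⊩-truncate j≤l a)) ◇Ψ))
              u⊩Ψ

  Exactly : (K : Model n) → S K → (ℕ → Bool) → Set
  Exactly K u s = All (λ q → V K q u ≡ s q) P

  module Exact (K : Model n) where
    open Realisation K (Exactly K) public

    ⊨⇒⊩ : ∀ {j u} (t : Desc j) → K , u ⊨ ⟦ t ⟧ → u ⊩ t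
    ⊨⇒⊩ {zero} s u⊨t = ⊨minterm⇒ K P s u⊨t
    ⊨⇒⊩ {suc j} (s , Ψ) (u⊨s , u⊨Ψ) = ⊨minterm⇒ K P s u⊨s ,
      All.map (λ {B} (u⊨□ , u⊨◇) →
                (λ v uv → Any.map (λ {a} → ⊨⇒⊩ a) (⊨⋁⇒Any K ⟦_⟧ (Ψ B) (u⊨□ v uv))) ,
                All.map (λ {a} → ◇-map {K = K} (⊨⇒⊩ a))
                        (AllP.map⁻ (⊨⋀⇒All K (𝐃̂ B) (map ⟦_⟧ (Ψ B)) u⊨◇)))
              (⊨⋀⇒All K (λ B → ∇ B (map ⟦_⟧ (Ψ B))) 𝒫⁺ u⊨Ψ)

    ⊩⇒⊨ : ∀ {j u} (t : Desc j) → u ⊩ t → K , u ⊨ ⟦ t ⟧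
    ⊩⇒⊨ {zero} s u⊩t = ⊨minterm⇐ K P s u⊩t
    ⊩⇒⊨ {suc j} (s , Ψ) (u⊩s , u⊩Ψ) = ⊨minterm⇐ K P s u⊩s ,
      All⇒⊨⋀ K (λ B → ∇ B (map ⟦_⟧ (Ψ B))) 𝒫⁺
        (All.map (λ {B} (□Ψ , ◇Ψ) →
                   (λ v uv → Any⇒⊨⋁ K ⟦_⟧ (Ψ B) (Any.map (λ {a} → ⊩⇒⊨ a) (□Ψ v uv))) ,
                   All⇒⊨⋀ K (𝐃̂ B) (map ⟦_⟧ (Ψ B))
                          (AllP.map⁺ (All.map (λ {a} → ◇-map {K = K} (⊩⇒⊨ a)) ◇Ψ)))
                 u⊩Ψ)

    ⊩-resp-≈ : ∀ {j u} {a b : Desc j} → a ≈ b → u ⊩ a → u ⊩ b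
    ⊩-resp-≈ {zero} a≈b u⊩a = All.zipWith (λ (e , e′) → trans e e′) (u⊩a , a≈b)
    ⊩-resp-≈ {suc j} (s≈s′ , Ψ≈Ψ′) (u⊩s , u⊩Ψ) = ⊩-resp-≈ {zero} s≈s′ u⊩s ,
      All.zipWith (λ ((forth , back) , (□Ψ , ◇Ψ)) →
                     (λ v uv → let a≈ , v⊩a = All.lookupAny forth (□Ψ v uv)
                               in Any.map (λ a≈b → ⊩-resp-≈ a≈b v⊩a) a≈) ,
                     All.map (λ ≈b → let ◇a , a≈b = All.lookupAny ◇Ψ ≈b
                                     in ◇-map {K = K} (⊩-resp-≈ a≈b) ◇a) back)
                  (Ψ≈Ψ′ , u⊩Ψ)

    ◇□⇒Any : ∀ {j B u} {X : S K → Set} {Q : Desc j → Set} {bs : List (Desc j)} →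
             (∀ b → Dec (Q b)) → (∀ {v b} → X v → v ⊩ b → Q b) →
             ◇ K B X u → □ K B (λ v → Any (v ⊩_) bs) u → Any Q bs
    ◇□⇒Any Q? X⊩⇒Q ◇X □bs =
      decidable-stable (Any.any? Q? _) (λ ¬Q → ◇X (λ v uv x → ¬Q (Any.map (X⊩⇒Q x) (□bs v uv))))

    ⊩⇒≈ : ∀ {j u} {a b : Desc j} → u ⊩ a → u ⊩ b → a ≈ b
    ⊩⇒≈ {zero} u⊩a u⊩b = All.zipWith (λ (e , e′) → trans (sym e) e′) (u⊩a , u⊩b)
    ⊩⇒≈ {suc j} (u⊩s , u⊩Ψ) (u⊩s′ , u⊩Ψ′) = ⊩⇒≈ {zero} u⊩s u⊩s′ ,
      All.zipWith (λ ((□Ψ , ◇Ψ) , (□Ψ′ , ◇Ψ′)) →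
                     All.map (λ {a} ◇a → ◇□⇒Any (a ≈?_) ⊩⇒≈ ◇a □Ψ′) ◇Ψ ,
                     All.map (λ {b} ◇b → ◇□⇒Any (_≈? b) (λ v⊩b v⊩a → ⊩⇒≈ v⊩a v⊩b) ◇b □Ψ) ◇Ψ′)
                  (u⊩Ψ , u⊩Ψ′)

    ⊩-successor-match : ∀ {j l l₁ C u v} {t : Desc (suc l)} {a : Desc l₁} →
                        (j≤l₁ : j ≤ l₁) (j≤l : j ≤ l) → u ⊩ t → C ∈ 𝒫⁺ → RB K C u v → v ⊩ a →
                        Any (λ κ → truncate j≤l₁ a ≈ truncate j≤l κ) (proj₂ t C)
    ⊩-successor-match {a = a} j≤l₁ j≤l u⊩t C∈ uv v⊩a =
      Any.map (λ {κ} v⊩κ → ⊩⇒≈ (⊩-truncate j≤l₁ a v⊩a) (⊩-truncate j≤l κ v⊩κ))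
              (proj₁ (All.lookup (proj₂ u⊩t) C∈) _ uv)

    Realisable : ∀ {l} → Desc l → Set
    Realisable t = ¬ ¬ ∃ (_⊩ t)

    Edge : ∀ {l l₁} → Desc (suc l) → Subset n → Desc l₁ → Set
    Edge t C a = ¬ ¬ ∃₂ λ u v → u ⊩ t × RB K C u v × v ⊩ a

    Edge⇒Realisable : ∀ {l l₁ C} {t : Desc (suc l)} {a : Desc l₁} → Edge t C a → Realisable a
    Edge⇒Realisable e ∄a = e (λ (_ , v , _ , _ , v⊩a) → ∄a (v , v⊩a))

    Realisable⇒Edge : ∀ {l C a} {t : Desc (suc l)} →
                      Realisable t → C ∈ 𝒫⁺ → a ∈ proj₂ t C → Edge t C a
    Realisable⇒Edge r C∈ a∈ ∄e =
      r (λ (u , u⊩t) → All.lookup (proj₂ (All.lookup (proj₂ u⊩t) C∈)) a∈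
                         (λ v uv v⊩a → ∄e (u , v , u⊩t , uv , v⊩a)))

    Realisable⇒self-Edge : ∀ {l C} {t : Desc (suc l)} → IsTnD K → Realisable t → Edge t C t
    Realisable⇒self-Edge refl-K r ∄e =
      r (λ (u , u⊩t) → ∄e (u , u , u⊩t , (λ i _ → refl-K i u) , u⊩t))

    Edge-antitone : ∀ {l l₁ B C} {t : Desc (suc l)} {a : Desc l₁} → C ⊆ B → Edge t B a → Edge t C a
    Edge-antitone C⊆B e ∄e =
      e (λ (u , v , u⊩t , uv , v⊩a) → ∄e (u , v , u⊩t , RB-antitone {K = K} C⊆B uv , v⊩a))

    Edge⇒match : ∀ {j l l₁ C} {t : Desc (suc l)} {a : Desc l₁} (j≤l₁ : j ≤ l₁) (j≤l : j ≤ l) →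
                 Edge t C a → C ∈ 𝒫⁺ → Any (λ κ → truncate j≤l₁ a ≈ truncate j≤l κ) (proj₂ t C)
    Edge⇒match {a = a} j≤l₁ j≤l e C∈ =
      decidable-stable (Any.any? (λ κ → truncate j≤l₁ a ≈? truncate j≤l κ) _)
        (λ ¬match → e (λ (_ , _ , u⊩t , uv , v⊩a) →
                         ¬match (⊩-successor-match j≤l₁ j≤l u⊩t C∈ uv v⊩a)))

  ^-𝐃̂ : ∀ p {j} B (a : Desc j) → 𝐃̂ B ⟦ a ⟧ ^ p ≡ 𝐃̂ B (⟦ a ⟧ ^ p)
  ^-𝐃̂ p {zero} B s = ^-𝐃̂-⋀ p B (map (literal s) P)
  ^-𝐃̂ p {suc j} B a = refl

  AgreesOff : ℕ → (K : Model n) → S K → (ℕ → Bool) → Set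
  AgreesOff p K u s = All (λ q → q ≢ p → V K q u ≡ s q) P

  module Reduct (p : ℕ) (K : Model n) where
    open Realisation K (AgreesOff p K) public

    ⊨^⇒⊩ : ∀ {j u} (t : Desc j) → K , u ⊨ (⟦ t ⟧ ^ p) → u ⊩ t
    ⊨^⇒⊩ {zero} s u⊨t = ⊨minterm^⇒ K p P s u⊨t
    ⊨^⇒⊩ {suc j} {u} (s , Ψ) (u⊨s , u⊨Ψ) = ⊨minterm^⇒ K p P s u⊨s ,
      All.map (λ {B} (u⊨□ , u⊨◇) →
                (λ v uv → Any.map (λ {a} → ⊨^⇒⊩ a) (⊨⋁^⇒Any K p ⟦_⟧ (Ψ B) (u⊨□ v uv))) ,
                All.map (λ {a} u⊨◇a → ◇-map {K = K} (⊨^⇒⊩ a) (subst (K , u ⊨_) (^-𝐃̂ p B a) u⊨◇a))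
                        (AllP.map⁻ (⊨⋀^⇒All K p (𝐃̂ B) (map ⟦_⟧ (Ψ B)) u⊨◇)))
              (⊨⋀^⇒All K p (λ B → ∇ B (map ⟦_⟧ (Ψ B))) 𝒫⁺ u⊨Ψ)

  module Unravelling (p : ℕ) (N : Model n) (N-refl : IsTnD N) (M′ : Model n) (M′-refl : IsTnD M′)
    where
    open Exact N using (Realisable; Edge; Edge⇒Realisable; Realisable⇒Edge; Realisable⇒self-Edge;
                        Edge-antitone; Edge⇒match)
    open Reduct p M′ using (⊩-sign) renaming (_⊩_ to _⊩′_)

    -- B is the group through which the node is entered from its parent.
    data World : Set where
      node : (l : ℕ) (w : S M′) (t : Desc l) (B : Subset n) → w ⊩′ t → Realisable t → World
      copy : S M′ → World

    data Access (i : Fin n) : World → World → Set where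
      stay : ∀ {x} → Access i x x
      down : ∀ {l w t B m r w₂ t₂ B₂ m₂ r₂} → i ∈ₛ B₂ → R M′ i w w₂ → Edge t B₂ t₂ →
             Access i (node (suc l) w t B m r) (node l w₂ t₂ B₂ m₂ r₂)
      leave : ∀ {w t B m r w₂} → R M′ i w w₂ → Access i (node zero w t B m r) (copy w₂)
      follow : ∀ {w w₂} → R M′ i w w₂ → Access i (copy w) (copy w₂)

    value : ℕ → World → Bool
    value q (node l w t B m r) with q ≟ p
    ... | yes _ = sign t q
    ... | no _ = V M′ q w
    value q (copy w) = V M′ q w

    M : Model n
    M = record { S = World ; R = Access ; V = value }

    M-refl : IsTnD M
    M-refl i x = stay

    open Exact M using () renaming (_⊩_ to _⊩ᴹ_; ⊩-resp-≈ to ⊩ᴹ-resp-≈)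

    node-sign : ∀ {l w} (t : Desc l) B m r → Exactly M (node l w t B m r) (sign t)
    node-sign {l} {w} t B m r = All.map (λ {q} → agree q) (⊩-sign t m)
      where
      agree : ∀ q → (q ≢ p → V M′ q w ≡ sign t q) → value q (node l w t B m r) ≡ sign t q
      agree q w⊨q with q ≟ p
      ... | yes _ = refl
      ... | no q≢p = w⊨q q≢p

    down-group : ∀ {C l w t B m r w₂ t₂ B₂ m₂ r₂} →
                 RB M C (node (suc l) w t B m r) (node l w₂ t₂ B₂ m₂ r₂) → C ⊆ B₂
    down-group x→y {i} i∈C with x→y i i∈C
    ... | down i∈B₂ _ _ = i∈B₂

    enter : ∀ {l w t B m r C κ w₂} (e : Edge t C κ) → RB M′ C w w₂ → (m₂ : w₂ ⊩′ κ) →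
            RB M C (node (suc l) w t B m r) (node l w₂ κ C m₂ (Edge⇒Realisable {a = κ} e))
    enter e ww₂ _ i i∈C = down i∈C (ww₂ i i∈C) e

    truth : ∀ {j l w t B m r} (j≤l : j ≤ l) → node l w t B m r ⊩ᴹ truncate j≤l t
    truth {zero} {t = t} {B} {m} {r} _ = node-sign t B m r
    truth {suc j} {suc l} {w} {s , Ψ} {B} {m} {r} (s≤s j≤l) =
      node-sign (s , Ψ) B m r , All.tabulate (λ C∈ → box C∈ , AllP.map⁺ (All.tabulate (diamond C∈)))
      where
      x : World
      x = node (suc l) w (s , Ψ) B m r

      successor : ∀ {C y l₁} {a : Desc l₁} → C ∈ 𝒫⁺ → Edge (s , Ψ) C a → (j≤l₁ : j ≤ l₁) →
                  y ⊩ᴹ truncate j≤l₁ a → Any (y ⊩ᴹ_) (map (truncate j≤l) (Ψ C))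
      successor C∈ e j≤l₁ y⊩a =
        AnyP.map⁺ (Any.map (λ a≈κ → ⊩ᴹ-resp-≈ a≈κ y⊩a) (Edge⇒match j≤l₁ j≤l e C∈))

      box : ∀ {C} → C ∈ 𝒫⁺ → □ M C (λ y → Any (y ⊩ᴹ_) (map (truncate j≤l) (Ψ C))) x
      box C∈ y x→y with nonemptySubsets-nonempty C∈
      ... | i , i∈C with x→y i i∈C
      ...   | stay =
        successor C∈ (Realisable⇒self-Edge N-refl r) (m≤n⇒m≤1+n j≤l) (truth (m≤n⇒m≤1+n j≤l))
      ...   | down {t₂ = t₂} _ _ e =
        successor C∈ (Edge-antitone {a = t₂} (down-group x→y) e) j≤l (truth j≤l)

      diamond : ∀ {C κ} → C ∈ 𝒫⁺ → κ ∈ Ψ C → ◇ M C (_⊩ᴹ truncate j≤l κ) x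
      diamond C∈ κ∈ □¬κ =
        All.lookup (proj₂ (All.lookup (proj₂ m) C∈)) κ∈
          (λ w₂ ww₂ w₂⊩κ → □¬κ _ (enter (Realisable⇒Edge r C∈ κ∈) ww₂ w₂⊩κ) (truth j≤l))

    point : World → S M′
    point (node _ w _ _ _ _) = w
    point (copy w) = w

    point-forth : ∀ {i x y} → Access i x y → R M′ i (point x) (point y)
    point-forth {i} {x} stay = M′-refl i (point x)
    point-forth (down _ ww₂ _) = ww₂
    point-forth (leave ww₂) = ww₂
    point-forth (follow ww₂) = ww₂

    value-off-p : ∀ {q} x → q ≢ p → value q x ≡ V M′ q (point x)
    value-off-p {q} (node l w t B m r) q≢p with q ≟ p
    ... | yes q≡p = ⊥-elim (q≢p q≡p)
    ... | no _ = refl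
    value-off-p (copy w) _ = refl

    point-back : ∀ {C} x → Nonempty C → ∀ w₂ → RB M′ C (point x) w₂ →
                 ∃ λ y → RB M C x y × point y ≡ w₂
    point-back (copy w) _ _ ww₂ = copy _ , (λ i i∈C → follow (ww₂ i i∈C)) , refl
    point-back (node zero w t B m r) _ _ ww₂ = copy _ , (λ i i∈C → leave (ww₂ i i∈C)) , refl
    point-back (node (suc l) w t B m r) C≠∅ _ ww₂ =
      let C∈ = ∈-nonemptySubsets C≠∅
          κ , κ∈ , w₂⊩κ = find (proj₁ (All.lookup (proj₂ m) C∈) _ ww₂)
      in _ , enter (Realisable⇒Edge {t = t} r C∈ κ∈) ww₂ w₂⊩κ , refl

    point-bisim : ∀ x → CollBisim p M x M′ (point x)
    point-bisim x = (λ y w′ → point y ≡ w′) , refl , λ { y _ refl →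
      (λ q q≢p → value-off-p y q≢p) ,
      λ C C≠∅ → (λ v yv → point v , (λ i i∈C → point-forth (yv i i∈C)) , refl) ,
                point-back y C≠∅ }

    open Exact N using ()
      renaming (_⊩_ to _⊩ᴺ_; ⊨⇒⊩ to ⊨⇒⊩ᴺ; ⊩⇒≈ to ⊩ᴺ⇒≈; ⊩-truncate to ⊩ᴺ-truncate)
    open Exact M using () renaming (⊩⇒⊨ to ⊩ᴹ⇒⊨)
    open Reduct p M′ using (⊨^⇒⊩)

    unravel : ∀ {k δ u s′} → Σ (Desc k) (λ t → ⟦ t ⟧ ≡ δ) → N , u ⊨ δ → M′ , s′ ⊨ (δ ^ p) →
              Σ (Model n) λ K → IsTnD K × Σ (S K) λ s → (K , s ⊨ δ) × CollBisim p K s M′ s′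
    unravel {k} {u = u} {s′} (t , refl) u⊨t s′⊨t^p =
      M , M-refl , root , ⊩ᴹ⇒⊨ t root⊩t , point-bisim root
      where
      u⊩t : u ⊩ᴺ t
      u⊩t = ⊨⇒⊩ᴺ t u⊨t

      s′⊩t : s′ ⊩′ t
      s′⊩t = ⊨^⇒⊩ t s′⊨t^p

      realisable : Realisable t
      realisable ∄u = ∄u (_ , u⊩t)

      root : World
      root = node _ s′ t ∅ s′⊩t realisable

      root⊩truncation : root ⊩ᴹ truncate ≤-refl t
      root⊩truncation = truth {k} ≤-refl

      -- truncate ≤-refl t is ≈ t, as both are realised at u.
      root⊩t : root ⊩ᴹ t
      root⊩t = ⊩ᴹ-resp-≈ {k} (⊩ᴺ⇒≈ {k} (⊩ᴺ-truncate ≤-refl t u⊩t) u⊩t) root⊩truncation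

lemma4p3 : (n : ℕ) → n ≥ 1 → (P : List ℕ) → (p : ℕ) → p ∈ P → (k : ℕ) →
    (δ : Form n) → InDT n P k δ →
    (M' : Model n) → IsTnD M' → (s' : S M') → M' , s' ⊨ (δ ^ p) →
    Σ (Model n) λ M → IsTnD M × Σ (S M) λ s → (M , s ⊨ δ) × CollBisim p M s M' s'
lemma4p3 n _ P p _ k δ (δ∈D , N , N-refl , u , u⊨δ) M′ M′-refl s′ s′⊨δ^p =
  unravel (fromInD k δ∈D) u⊨δ s′⊨δ^p
  where
  open Descriptions n P
  open Unravelling p N N-refl M′ M′-refl
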